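{- Let $m\ge 2$. For all $n\ge 1$ and all $k\ge 0$, $$|\{\pi\in\mathcal{S}_n:{\sf a}_m(\pi)=k\}|=|\{\pi\in\mathcal{S}_n:{\sf b}_m(\pi)=k\}|.$$
   Context: For $\tau\in\mathcal{S}_m$, an occurrence of $\tau$ in $\pi\in\mathcal{S}_n$ is a sequence $1\le i_1<\dots<i_m\le n$ such that $\pi_{i_1}\cdots\pi_{i_m}$ is order-isomorphic to $\tau$. Let $A_m=\{\tau\in\mathcal{S}_m:\tau_{m-1}=m,\ \tau_m=m-1\}$ and $B_m=\{\tau\in\mathcal{S}_m:\tau_{m-1}=m-1,\ \tau_m=m\}$. ${\sf a}_m(\pi)$ (resp. ${\sf b}_m(\pi)$) is the number of distinct pairs $(i,j)$, $1\le i<j\le n$, such that $i,j$ are the final two terms of some occurrence in $\pi$ of some pattern belonging to $A_m$ (resp. $B_m$). -}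

module Defs where

open import Level using (0ℓ)
open import Data.Nat using (ℕ; _∸_)
open import Data.Fin using (Fin; toℕ; _<_)
open import Data.Fin.Permutation using (Permutation′; _⟨$⟩ʳ_)
open import Data.Product using (Σ; ∃; _×_; _,_; proj₁)
open import Function.Bundles using (_⇔_)
open import Function.Definitions using (Injective)
open import Relation.Binary.PropositionalEquality using (_≡_; refl; sym; trans)
open import Relation.Binary.Bundles using (Setoid)

-- Permutations of [n] are Permutation′ n (bijections Fin n → Fin n); positions and
-- values are 0-indexed, so 1-indexed position/value p corresponds to toℕ x ≡ p ∸ 1.

IsOccurrence : {m n : ℕ} → Permutation′ m → Permutation′ n → (Fin m → Fin n) → Set
IsOccurrence τ π f =
  (∀ x y → x < y → f x < f y) ×
  (∀ x y → ((π ⟨$⟩ʳ f x) < (π ⟨$⟩ʳ f y)) ⇔ ((τ ⟨$⟩ʳ x) < (τ ⟨$⟩ʳ y)))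

InA : (m : ℕ) → Permutation′ m → Set
InA m τ = (∀ x → toℕ x ≡ m ∸ 2 → toℕ (τ ⟨$⟩ʳ x) ≡ m ∸ 1)
        × (∀ x → toℕ x ≡ m ∸ 1 → toℕ (τ ⟨$⟩ʳ x) ≡ m ∸ 2)

InB : (m : ℕ) → Permutation′ m → Set
InB m τ = (∀ x → toℕ x ≡ m ∸ 2 → toℕ (τ ⟨$⟩ʳ x) ≡ m ∸ 2)
        × (∀ x → toℕ x ≡ m ∸ 1 → toℕ (τ ⟨$⟩ʳ x) ≡ m ∸ 1)

FinalPair : (m : ℕ) → (Permutation′ m → Set) → {n : ℕ} → Permutation′ n
          → Fin n × Fin n → Set
FinalPair m C π (i , j) =
  (i < j) ×
  Σ (Permutation′ m) λ τ → C τ ×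
  Σ (Fin m → Fin _) λ f → IsOccurrence τ π f ×
    (∀ x → toℕ x ≡ m ∸ 2 → f x ≡ i) × (∀ x → toℕ x ≡ m ∸ 1 → f x ≡ j)

HasCard : {A : Set} → ℕ → (A → Set) → Set
HasCard {A} k P =
  Σ (Fin k → A) λ e → Injective _≡_ _≡_ e × (∀ a → P a ⇔ ∃ λ t → e t ≡ a)

a≡ : (m : ℕ) → {n : ℕ} → Permutation′ n → ℕ → Set
a≡ m π k = HasCard k (FinalPair m (InA m) π)

b≡ : (m : ℕ) → {n : ℕ} → Permutation′ n → ℕ → Set
b≡ m π k = HasCard k (FinalPair m (InB m) π)

PermSetoid : (n : ℕ) → (Permutation′ n → Set) → Setoid 0ℓ 0ℓ
PermSetoid n Q = record
  { Carrier = Σ (Permutation′ n) Q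
  ; _≈_ = λ p q → ∀ i → (proj₁ p ⟨$⟩ʳ i) ≡ (proj₁ q ⟨$⟩ʳ i)
  ; isEquivalence = record
    { refl = λ i → refl
    ; sym = λ e i → sym (e i)
    ; trans = λ e f i → trans (e i) (f i)
    }
  }

{-# OPTIONS --safe #-}
module Submission where

-- Write m = d + 2, with positions and values counted from 0. The pair (i , j), i < j, ends an
-- occurrence of a pattern of A_m exactly when π j < π i and at least d positions before i carry
-- values below π j; for B_m, when π i < π j and at least d earlier values lie below π i. So both
-- statistics are sums over i of a row count that depends only on x = π i and on the set S of
-- values seen before i. Call an unseen value high when at least d seen values lie below it. The
-- A-row of x counts the high values below x; the B-row of x counts the unseen values above x when
-- x is high (they are then all high) and is 0 otherwise.
--
-- Reading π from left to right, Φ π keeps each value that is not high and replaces a high value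
-- with r high values below it by the high value, with respect to the values already placed in
-- Φ π, that has r high values above it. The two sets of seen values keep the same size and agree
-- on the low values, so they have equally many high values; this makes every step possible and
-- self-inverse. Hence Φ is an involution turning each A-row of π into the B-row of Φ π.

open import Data.Bool.Base using (Bool; false; T; _∨_; if_then_else_)
open import Data.Fin.Base as Fin using (Fin; zero; suc; toℕ; fromℕ<; punchOut; _↑ˡ_; _↑ʳ_; remQuot)
open import Data.Fin.Permutation using (Permutation′; permutation; _⟨$⟩ʳ_; _⟨$⟩ˡ_; inverseˡ; inverseʳ)
open import Data.Fin.Properties as Fin
  using ( toℕ-injective; toℕ-fromℕ<; toℕ<n; injective⇒≤; punchOut-injective; any?; _≟_
        ; *↔×; remQuot-combine; splitAt-↑ʳ )
open import Data.Nat.Base as ℕ using (ℕ; zero; suc; _+_; _*_; _≤_; _<_; z≤n; s≤s)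
import Data.Nat.Properties as ℕ
open import Algebra.Properties.Monoid.Sum ℕ.+-0-monoid using (sum; sum-cong-≗)
open import Data.Product.Base using (∃; _×_; _,_; proj₁; proj₂; map₁; map₂)
open import Data.Product.Function.NonDependent.Propositional using (_×-⇔_)
open import Data.Sum.Base as Sum using (_⊎_; inj₁; inj₂)
open import Data.Sum.Function.Propositional using (_⊎-⇔_)
open import Data.Unit.Base using (tt)
open import Data.Vec.Functional using (_∷_; head; tail)
open import Function.Base using (_∘_; id; flip)
open import Function.Bundles using (_⇔_; mk⇔; Equivalence; Inverse; _↔_; Injection)
open import Function.Definitions using (Injective)
open import Function.Properties.Equivalence using ()
  renaming (refl to ⇔-refl; sym to ⇔-sym; trans to ⇔-trans)
open import Function.Properties.Inverse using (↔⇒↣)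
open import Function.Related.TypeIsomorphisms using (¬-cong-⇔)
open import Level using (0ℓ)
open import Relation.Binary.Definitions using (tri<; tri≈; tri>)
open import Relation.Binary.PropositionalEquality
open import Relation.Nullary using (Dec; yes; no; does; ¬_; contradiction)
open import Relation.Nullary.Decidable using (T?; _×-dec_; _⊎-dec_; ¬?; does-⇔; decidable-stable)
open import Relation.Unary using (Pred; Decidable; _⊆_)

open import Defs

private variable
  k l N : ℕ
  P Q : Pred (Fin N) 0ℓ

-- Fin._<?_ is heterogeneous, which would leave the size of a literal zero undetermined.
infix 4 _<?_
_<?_ : (y z : Fin N) → Dec (y Fin.< z)
_<?_ = Fin._<?_

subst⇔ : {A : Set} (P : A → Set) {a b : A} → a ≡ b → P a ⇔ P b
subst⇔ P eq = mk⇔ (subst P eq) (subst P (sym eq))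

-- Counting

count : Decidable P → ℕ
count {zero}  P? = 0
count {suc N} P? = if does (P? zero) then suc (count (P? ∘ suc)) else count (P? ∘ suc)

count-cong : (P? : Decidable P) (Q? : Decidable Q) → (∀ i → P i ⇔ Q i) → count P? ≡ count Q?
count-cong {zero}  P? Q? P⇔Q = refl
count-cong {suc N} P? Q? P⇔Q =
  cong₂ (λ b c → if b then suc c else c) (does-⇔ (P⇔Q zero) (P? zero) (Q? zero))
        (count-cong (P? ∘ suc) (Q? ∘ suc) (P⇔Q ∘ suc))

count-mono : (P? : Decidable P) (Q? : Decidable Q) → P ⊆ Q → count P? ≤ count Q?
count-mono {zero}  P? Q? P⊆Q = z≤n
count-mono {suc N} P? Q? P⊆Q with P? zero | Q? zero
... | yes _ | yes _ = s≤s (count-mono (P? ∘ suc) (Q? ∘ suc) P⊆Q)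
... | yes p | no ¬q = contradiction (P⊆Q p) ¬q
... | no _  | yes _ = ℕ.m≤n⇒m≤1+n (count-mono (P? ∘ suc) (Q? ∘ suc) P⊆Q)
... | no _  | no _  = count-mono (P? ∘ suc) (Q? ∘ suc) P⊆Q

count-mono-< : (P? : Decidable P) (Q? : Decidable Q) → P ⊆ Q →
               ∀ {i} → ¬ P i → Q i → count P? < count Q?
count-mono-< {suc N} P? Q? P⊆Q {zero} ¬p q with P? zero | Q? zero
... | yes p | _     = contradiction p ¬p
... | no _  | yes _ = s≤s (count-mono (P? ∘ suc) (Q? ∘ suc) P⊆Q)
... | no _  | no ¬q = contradiction q ¬q
count-mono-< {suc N} P? Q? P⊆Q {suc i} ¬p q with P? zero | Q? zero
... | yes _ | yes _ = s≤s (count-mono-< (P? ∘ suc) (Q? ∘ suc) P⊆Q ¬p q)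
... | yes p | no ¬q = contradiction (P⊆Q p) ¬q
... | no _  | yes _ = ℕ.m<n⇒m<1+n (count-mono-< (P? ∘ suc) (Q? ∘ suc) P⊆Q ¬p q)
... | no _  | no _  = count-mono-< (P? ∘ suc) (Q? ∘ suc) P⊆Q ¬p q

count-none : (P? : Decidable P) → (∀ i → ¬ P i) → count P? ≡ 0
count-none {zero}  P? ¬P = refl
count-none {suc N} P? ¬P with P? zero
... | yes p = contradiction p (¬P zero)
... | no _  = count-none (P? ∘ suc) (¬P ∘ suc)

count-all : (P? : Decidable P) → (∀ (i : Fin N) → P i) → count P? ≡ N
count-all {zero}  P? allP = refl
count-all {suc N} P? allP with P? zero
... | yes _ = cong suc (count-all (P? ∘ suc) (allP ∘ suc))
... | no ¬p = contradiction (allP zero) ¬p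

count-complement : {P : Pred (Fin N) 0ℓ} (P? : Decidable P) → count P? + count (¬? ∘ P?) ≡ N
count-complement {zero}  P? = refl
count-complement {suc N} P? with P? zero
... | yes _ = cong suc (count-complement (P? ∘ suc))
... | no _  = trans (ℕ.+-suc _ _) (cong suc (count-complement (P? ∘ suc)))

count-partition : (P? : Decidable P) (Q? : Decidable Q) →
                  count P? ≡ count (λ i → P? i ×-dec Q? i) + count (λ i → P? i ×-dec ¬? (Q? i))
count-partition {zero}  P? Q? = refl
count-partition {suc N} P? Q? with P? zero | Q? zero
... | yes _ | yes _ = cong suc (count-partition (P? ∘ suc) (Q? ∘ suc))
... | yes _ | no _  = trans (cong suc (count-partition (P? ∘ suc) (Q? ∘ suc))) (sym (ℕ.+-suc _ _))
... | no _  | yes _ = count-partition (P? ∘ suc) (Q? ∘ suc)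
... | no _  | no _  = count-partition (P? ∘ suc) (Q? ∘ suc)

private
  suc-⊎ : ∀ {A : Set} {i x : Fin N} → (suc i ≡ suc x ⊎ A) ⇔ (i ≡ x ⊎ A)
  suc-⊎ = mk⇔ Fin.suc-injective (cong suc) ⊎-⇔ ⇔-refl

  zero≢suc-⊎ : ∀ {A : Set} {i : Fin N} → (suc i ≡ zero ⊎ A) ⇔ A
  zero≢suc-⊎ = mk⇔ (λ { (inj₁ ()) ; (inj₂ a) → a }) inj₂

count-insert : (P? : Decidable P) (Q? : Decidable Q) → ∀ {x} → ¬ P x →
               (∀ i → Q i ⇔ (i ≡ x ⊎ P i)) → count Q? ≡ suc (count P?)
count-insert {suc N} P? Q? {zero} ¬px Q⇔ with P? zero | Q? zero
... | yes px | _     = contradiction px ¬px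
... | no _   | no ¬q = contradiction (Equivalence.from (Q⇔ zero) (inj₁ refl)) ¬q
... | no _   | yes _ =
  cong suc (count-cong (Q? ∘ suc) (P? ∘ suc) (λ i → ⇔-trans (Q⇔ (suc i)) zero≢suc-⊎))
count-insert {suc N} P? Q? {suc x} ¬px Q⇔ with P? zero | Q? zero
... | yes p  | no ¬q = contradiction (Equivalence.from (Q⇔ zero) (inj₂ p)) ¬q
... | no ¬p  | yes q = contradiction (Equivalence.to (Q⇔ zero) q) λ { (inj₁ ()) ; (inj₂ p) → ¬p p }
... | yes _  | yes _ =
  cong suc (count-insert (P? ∘ suc) (Q? ∘ suc) ¬px (λ i → ⇔-trans (Q⇔ (suc i)) suc-⊎))
... | no _   | no _  = count-insert (P? ∘ suc) (Q? ∘ suc) ¬px (λ i → ⇔-trans (Q⇔ (suc i)) suc-⊎)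

count-toℕ< : ∀ {c} → c ≤ N → count (λ (i : Fin N) → toℕ i ℕ.<? c) ≡ c
count-toℕ< {N}     {zero}  _         = count-none (λ (i : Fin N) → toℕ i ℕ.<? 0) (λ i ())
count-toℕ< {suc N} {suc c} (s≤s c≤N) = cong suc (trans
  (count-cong (λ (i : Fin N) → suc (toℕ i) ℕ.<? suc c) (λ i → toℕ i ℕ.<? c) (λ i → mk⇔ ℕ.≤-pred s≤s))
  (count-toℕ< c≤N))

count-≢ : (p : Fin (suc N)) → count (λ i → ¬? (i ≟ p)) ≡ N
count-≢ zero            = count-all (λ i → ¬? (suc i ≟ zero)) (λ i ())
count-≢ {suc N} (suc p) = cong suc (trans
  (count-cong (λ i → ¬? (suc i ≟ suc p)) (λ i → ¬? (i ≟ p))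
              (λ i → mk⇔ (λ ne → ne ∘ cong suc) (λ ne → ne ∘ Fin.suc-injective)))
  (count-≢ p))

count-↑ : ∀ k {l} {P : Pred (Fin (k + l)) 0ℓ} (P? : Decidable P) →
          count P? ≡ count (λ i → P? (i ↑ˡ l)) + count (λ j → P? (k ↑ʳ j))
count-↑ zero    P? = refl
count-↑ (suc k) P? with P? zero
... | yes _ = cong suc (count-↑ k (P? ∘ suc))
... | no _  = count-↑ k (P? ∘ suc)

private
  remQuot-↑ʳ : ∀ {k} l (c : Fin (k * l)) → remQuot {suc k} l (l ↑ʳ c) ≡ map₁ suc (remQuot {k} l c)
  remQuot-↑ʳ {k} l c rewrite splitAt-↑ʳ l (k * l) c = refl

count-pairs : ∀ k {l} {Q : Pred (Fin k × Fin l) 0ℓ} (Q? : Decidable Q) →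
              count (Q? ∘ remQuot l) ≡ sum (λ i → count (λ j → Q? (i , j)))
count-pairs zero            Q? = refl
count-pairs (suc k) {l} {Q} Q? = trans (count-↑ l (Q? ∘ remQuot l)) (cong₂ _+_
  (count-cong (λ j → Q? (remQuot l (j ↑ˡ k * l))) (λ j → Q? (zero , j))
              (λ j → subst⇔ Q (remQuot-combine zero j)))
  (trans (count-cong (λ c → Q? (remQuot l (l ↑ʳ c))) (λ c → Q? (map₁ suc (remQuot l c)))
                     (λ c → subst⇔ Q (remQuot-↑ʳ l c)))
         (count-pairs k (λ (i , j) → Q? (suc i , j)))))


strictMono⇒injective : {f : Fin k → Fin l} → (∀ {x y} → x Fin.< y → f x Fin.< f y) →
                       Injective _≡_ _≡_ f
strictMono⇒injective mono {x} {y} eq with Fin.<-cmp x y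
... | tri< x<y _ _ = contradiction (cong toℕ eq) (ℕ.<⇒≢ (mono x<y))
... | tri≈ _ x≡y _ = x≡y
... | tri> _ _ y<x = contradiction (cong toℕ (sym eq)) (ℕ.<⇒≢ (mono y<x))

enum : {P : Pred (Fin N) 0ℓ} (P? : Decidable P) → Fin (count P?) → Fin N
enum {suc N} P? t with P? zero
enum {suc N} P? zero    | yes _ = zero
enum {suc N} P? (suc t) | yes _ = suc (enum (P? ∘ suc) t)
enum {suc N} P? t       | no _  = suc (enum (P? ∘ suc) t)

enum-sound : (P? : Decidable P) (t : Fin (count P?)) → P (enum P? t)
enum-sound {suc N} P? t with P? zero
enum-sound {suc N} P? zero    | yes p = p
enum-sound {suc N} P? (suc t) | yes _ = enum-sound (P? ∘ suc) t
enum-sound {suc N} P? t       | no _  = enum-sound (P? ∘ suc) t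

enum-strictMono : (P? : Decidable P) {t u : Fin (count P?)} → t Fin.< u → enum P? t Fin.< enum P? u
enum-strictMono {suc N} P? {t} {u} t<u with P? zero
enum-strictMono {suc N} P? {zero}  {suc u} t<u       | yes _ = s≤s z≤n
enum-strictMono {suc N} P? {suc t} {suc u} (s≤s t<u) | yes _ = s≤s (enum-strictMono (P? ∘ suc) t<u)
enum-strictMono {suc N} P? {t}     {u}     t<u       | no _  = s≤s (enum-strictMono (P? ∘ suc) t<u)

enum-complete : (P? : Decidable P) → ∀ {i} → P i → ∃ λ t → enum P? t ≡ i
enum-complete {suc N} P? {i} p with P? zero
enum-complete {suc N} P? {zero}  p | yes _ = zero , refl
enum-complete {suc N} P? {suc i} p | yes _ =
  let t , eq = enum-complete (P? ∘ suc) p in suc t , cong suc eq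
enum-complete {suc N} P? {zero}  p | no ¬p = contradiction p ¬p
enum-complete {suc N} P? {suc i} p | no _  =
  let t , eq = enum-complete (P? ∘ suc) p in t , cong suc eq

countBelow countAbove : {P : Pred (Fin N) 0ℓ} → Decidable P → Fin N → ℕ
countBelow P? y = count (λ z → z <? y ×-dec P? z)
countAbove P? y = count (λ z → y <? z ×-dec P? z)

private
  suc<suc⇔ : ∀ {A : Set} {y z : Fin N} → (suc y Fin.< suc z × A) ⇔ (y Fin.< z × A)
  suc<suc⇔ = mk⇔ (map₁ ℕ.≤-pred) (map₁ s≤s)

  countBelow-suc : (P? : Decidable P) → ∀ y →
                   count (λ z → suc z <? suc y ×-dec P? (suc z)) ≡ countBelow (P? ∘ suc) y
  countBelow-suc P? y = count-cong (λ z → suc z <? suc y ×-dec P? (suc z))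
                                   (λ z → z <? y ×-dec P? (suc z)) (λ z → suc<suc⇔)

  countAbove-suc : (P? : Decidable P) → ∀ y →
                   count (λ z → suc y <? suc z ×-dec P? (suc z)) ≡ countAbove (P? ∘ suc) y
  countAbove-suc P? y = count-cong (λ z → suc y <? suc z ×-dec P? (suc z))
                                   (λ z → y <? z ×-dec P? (suc z)) (λ z → suc<suc⇔)

  countAbove-zero : (P? : Decidable P) → count (λ z → zero <? suc z ×-dec P? (suc z)) ≡ count (P? ∘ suc)
  countAbove-zero P? = count-cong (λ z → zero <? suc z ×-dec P? (suc z)) (P? ∘ suc)
                                  (λ z → mk⇔ proj₂ (s≤s z≤n ,_))

count-split : (P? : Decidable P) → ∀ {y} → P y → count P? ≡ countBelow P? y + suc (countAbove P? y)
count-split {suc N} P? {zero} p with P? zero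
... | no ¬p = contradiction p ¬p
... | yes _ = trans (cong suc (sym (countAbove-zero P?)))
                    (cong (_+ suc (countAbove P? zero)) (sym nothing-below))
  where
  nothing-below : count (λ z → suc z <? zero ×-dec P? (suc z)) ≡ 0
  nothing-below = count-none (λ z → suc z <? zero ×-dec P? (suc z)) (λ z → λ ())
count-split {suc N} P? {suc y} p with P? zero
... | yes _ = cong suc (trans (count-split (P? ∘ suc) p) (sym shifted))
  where shifted = cong₂ (λ a b → a + suc b) (countBelow-suc P? y) (countAbove-suc P? y)
... | no _  = trans (count-split (P? ∘ suc) p) (sym shifted)
  where shifted = cong₂ (λ a b → a + suc b) (countBelow-suc P? y) (countAbove-suc P? y)

countAbove-strict : (P? : Decidable P) → ∀ {x y} → x Fin.< y → P y → countAbove P? y < countAbove P? x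
countAbove-strict P? {x} {y} x<y py =
  count-mono-< (λ z → y <? z ×-dec P? z) (λ z → x <? z ×-dec P? z) (map₁ (ℕ.<-trans x<y))
               (λ (y<y , _) → ℕ.<-irrefl refl y<y) (x<y , py)

countAbove-injective : (P? : Decidable P) → ∀ {x y} → P x → P y →
                       countAbove P? x ≡ countAbove P? y → x ≡ y
countAbove-injective P? {x} {y} px py eq with Fin.<-cmp x y
... | tri< x<y _ _ = contradiction (sym eq) (ℕ.<⇒≢ (countAbove-strict P? x<y py))
... | tri≈ _ x≡y _ = x≡y
... | tri> _ _ y<x = contradiction eq (ℕ.<⇒≢ (countAbove-strict P? y<x px))

countAbove-surjective : (P? : Decidable P) → ∀ {r} → r < count P? → ∃ λ y → P y × countAbove P? y ≡ r
countAbove-surjective {suc N} P? {r} r<c with P? zero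
... | no _ = let y , py , eq = countAbove-surjective (P? ∘ suc) r<c in
             suc y , py , trans (countAbove-suc P? y) eq
... | yes p with r ℕ.<? count (P? ∘ suc)
...   | yes r<c′ = let y , py , eq = countAbove-surjective (P? ∘ suc) r<c′ in
                   suc y , py , trans (countAbove-suc P? y) eq
...   | no r≮c′  = zero , p , trans (countAbove-zero P?) (ℕ.≤-antisym (ℕ.≮⇒≥ r≮c′) (ℕ.≤-pred r<c))

select : {P : Pred (Fin N) 0ℓ} → Decidable P → Fin N → Fin N
select P? x with any? P?
... | yes (y , _) = y
... | no _        = x

select-sound : (P? : Decidable P) → ∀ {x y} → P y → P (select P? x)
select-sound P? py with any? P?
... | yes (_ , p) = p
... | no none     = contradiction (_ , py) none

-- Cardinalities

module _ {A : Set} {P : A → Set} where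

  HasCard-≤ : (g : Fin k → A) → Injective _≡_ _≡_ g → (∀ t → P (g t)) → HasCard l P → k ≤ l
  HasCard-≤ g g-inj gP (e , _ , e-img) = injective⇒≤ index-injective
    where
    index : ∀ t → ∃ λ s → e s ≡ g t
    index t = Equivalence.to (e-img (g t)) (gP t)
    index-injective : Injective _≡_ _≡_ (proj₁ ∘ index)
    index-injective {s} {t} eq = g-inj (begin
      g s                 ≡⟨ proj₂ (index s) ⟨
      e (proj₁ (index s)) ≡⟨ cong e eq ⟩
      e (proj₁ (index t)) ≡⟨ proj₂ (index t) ⟩
      g t                 ∎)
      where open ≡-Reasoning

  HasCard-unique : HasCard k P → HasCard l P → k ≡ l
  HasCard-unique c c′ = ℕ.≤-antisym (embed c c′) (embed c′ c)
    where
    embed : ∀ {k l} → HasCard k P → HasCard l P → k ≤ l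
    embed (e , e-inj , e-img) = HasCard-≤ e e-inj (λ t → Equivalence.from (e-img (e t)) (t , refl))

  HasCard-↔ : {B : Set} (f : A ↔ B) → HasCard k P → HasCard k (P ∘ Inverse.from f)
  HasCard-↔ f (e , e-inj , e-img) = to ∘ e , e-inj ∘ to-injective , λ b → mk⇔
    (λ p → let t , eq = Equivalence.to (e-img (from b)) p in
           t , trans (cong to eq) (strictlyInverseˡ b))
    (λ (t , eq) → Equivalence.from (e-img (from b))
                    (t , trans (sym (strictlyInverseʳ (e t))) (cong from eq)))
    where
    open Inverse f
    to-injective : Injective _≡_ _≡_ to
    to-injective {a} {a′} eq =
      trans (sym (strictlyInverseʳ a)) (trans (cong from eq) (strictlyInverseʳ a′))

HasCard-resp : {A : Set} {P Q : A → Set} → (∀ a → P a ⇔ Q a) → HasCard k P → HasCard k Q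
HasCard-resp P⇔Q (e , e-inj , e-img) = e , e-inj , λ a → ⇔-trans (⇔-sym (P⇔Q a)) (e-img a)

HasCard-cong : {A : Set} {P Q : A → Set} → (∀ a → P a ⇔ Q a) → HasCard k P ⇔ HasCard k Q
HasCard-cong P⇔Q = mk⇔ (HasCard-resp P⇔Q) (HasCard-resp (⇔-sym ∘ P⇔Q))

count-HasCard : {P : Pred (Fin N) 0ℓ} (P? : Decidable P) → HasCard (count P?) P
count-HasCard P? = enum P? , strictMono⇒injective (enum-strictMono P?) ,
                   λ i → mk⇔ (enum-complete P?) (λ (t , eq) → subst _ eq (enum-sound P? t))

count-permute : {P : Pred (Fin N) 0ℓ} (σ : Permutation′ N) (P? : Decidable P) →
                count (P? ∘ (σ ⟨$⟩ʳ_)) ≡ count P?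
count-permute {P = P} σ P? = HasCard-unique
  (HasCard-resp (λ i → subst⇔ P (inverseʳ σ)) (HasCard-↔ σ (count-HasCard (P? ∘ (σ ⟨$⟩ʳ_)))))
  (count-HasCard P?)

HasCard-pairs : ∀ {k l m} {Q : Pred (Fin k × Fin l) 0ℓ} (Q? : Decidable Q) →
                HasCard m Q ⇔ m ≡ sum (λ i → count (λ j → Q? (i , j)))
HasCard-pairs {k} {l} {Q = Q} Q? = mk⇔
  (λ c → trans (HasCard-unique c card) (count-pairs k Q?))
  (λ eq → subst (λ m → HasCard m Q) (trans (count-pairs k Q?) (sym eq)) card)
  where
  card : HasCard (count (Q? ∘ remQuot l)) Q
  card = HasCard-resp (λ (i , j) → subst⇔ Q (remQuot-combine i j))
                      (HasCard-↔ *↔× (count-HasCard (Q? ∘ remQuot l)))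

-- Permutations

⟨$⟩ʳ-injective : (σ : Permutation′ N) → Injective _≡_ _≡_ (σ ⟨$⟩ʳ_)
⟨$⟩ʳ-injective σ = Injection.injective (↔⇒↣ σ)

injective⇒surjective : {f : Fin N → Fin N} → Injective _≡_ _≡_ f → ∀ y → ∃ λ x → f x ≡ y
injective⇒surjective {suc N} {f} f-inj y with any? (λ x → f x ≟ y)
... | yes found = found
... | no ¬found = contradiction (injective⇒≤ punched-injective) ℕ.1+n≰n
  where
  punched : Fin (suc N) → Fin N
  punched x = punchOut {i = y} (λ eq → ¬found (x , sym eq))
  punched-injective : Injective _≡_ _≡_ punched
  punched-injective eq = f-inj (punchOut-injective {i = y} _ _ eq)

injective⇒permutation : (f : Fin N → Fin N) → Injective _≡_ _≡_ f → Permutation′ N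
injective⇒permutation f f-inj =
  permutation f (proj₁ ∘ onto) (proj₂ ∘ onto) (λ x → f-inj (proj₂ (onto (f x))))
  where
  onto : ∀ y → ∃ λ x → f x ≡ y
  onto = injective⇒surjective f-inj

rank : (Fin k → Fin l) → Fin k → ℕ
rank v x = count (λ y → v y <? v x)

module _ (v : Fin k → Fin l) where

  rank-strictMono : ∀ {x y} → v x Fin.< v y → rank v x < rank v y
  rank-strictMono {x} {y} vx<vy = count-mono-< (λ z → v z <? v x) (λ z → v z <? v y)
                                                (λ vz<vx → ℕ.<-trans vz<vx vx<vy) (ℕ.<-irrefl refl) vx<vy

  rank<length : ∀ x → rank v x < k
  rank<length x = ℕ.<-≤-trans
    (count-mono-< (λ z → v z <? v x) (λ _ → yes tt) _ (ℕ.<-irrefl refl) tt)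
    (ℕ.≤-reflexive (count-all (λ _ → yes tt) _))

  module _ (v-inj : Injective _≡_ _≡_ v) where

    rank-injective : Injective _≡_ _≡_ (rank v)
    rank-injective {x} {y} eq with Fin.<-cmp (v x) (v y)
    ... | tri< vx<vy _ _ = contradiction eq (ℕ.<⇒≢ (rank-strictMono vx<vy))
    ... | tri≈ _ vx≡vy _ = v-inj vx≡vy
    ... | tri> _ _ vy<vx = contradiction (sym eq) (ℕ.<⇒≢ (rank-strictMono vy<vx))

    standardise : Permutation′ k
    standardise = injective⇒permutation (λ x → fromℕ< (rank<length x))
      (λ eq → rank-injective (trans (sym (toℕ-fromℕ< _)) (trans (cong toℕ eq) (toℕ-fromℕ< _))))

    toℕ-standardise : ∀ x → toℕ (standardise ⟨$⟩ʳ x) ≡ rank v x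
    toℕ-standardise x = toℕ-fromℕ< (rank<length x)

    standardise-strictMono : ∀ {x y} → v x Fin.< v y → standardise ⟨$⟩ʳ x Fin.< standardise ⟨$⟩ʳ y
    standardise-strictMono {x} {y} vx<vy =
      subst₂ ℕ._<_ (sym (toℕ-standardise x)) (sym (toℕ-standardise y)) (rank-strictMono vx<vy)

    standardise-< : ∀ x y → (standardise ⟨$⟩ʳ x Fin.< standardise ⟨$⟩ʳ y) ⇔ (v x Fin.< v y)
    standardise-< x y = mk⇔ reflect standardise-strictMono
      where
      reflect : standardise ⟨$⟩ʳ x Fin.< standardise ⟨$⟩ʳ y → v x Fin.< v y
      reflect τx<τy with Fin.<-cmp (v x) (v y)
      ... | tri< vx<vy _ _ = vx<vy
      ... | tri≈ _ vx≡vy _ = contradiction (cong (standardise ⟨$⟩ʳ_) (v-inj vx≡vy)) (Fin.<⇒≢ τx<τy)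
      ... | tri> _ _ vy<vx = contradiction (standardise-strictMono vy<vx) (ℕ.<⇒≯ τx<τy)

-- Sets of values

ValueSet : ℕ → Set
ValueSet n = Fin n → Bool

module _ {n : ℕ} where

  ∅ : ValueSet n
  ∅ _ = false

  insert : Fin n → ValueSet n → ValueSet n
  insert x S v = does (v ≟ x) ∨ S v

  infix 4 _∈_ _∉_ _∈?_

  _∈_ _∉_ : Fin n → ValueSet n → Set
  v ∈ S = T (S v)
  v ∉ S = ¬ v ∈ S

  _∈?_ : ∀ v S → Dec (v ∈ S)
  v ∈? S = T? (S v)

  ∈-insert : ∀ x S {v} → v ∈ insert x S ⇔ (v ≡ x ⊎ v ∈ S)
  ∈-insert x S {v} with v ≟ x
  ... | yes v≡x = mk⇔ (λ _ → inj₁ v≡x) (λ _ → tt)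
  ... | no v≢x  = mk⇔ inj₂ λ { (inj₁ v≡x) → contradiction v≡x v≢x ; (inj₂ v∈S) → v∈S }

  insert-cong : ∀ {S S′} x → S ≗ S′ → insert x S ≗ insert x S′
  insert-cong x S≗S′ v = cong (does (v ≟ x) ∨_) (S≗S′ v)

  below : ValueSet n → Fin n → ℕ
  below S = countBelow (_∈? S)

  below-cong : ∀ {S S′} → S ≗ S′ → ∀ v → below S v ≡ below S′ v
  below-cong {S} {S′} S≗S′ v = count-cong (λ z → z <? v ×-dec z ∈? S) (λ z → z <? v ×-dec z ∈? S′)
                                          (λ z → ⇔-refl ×-⇔ subst⇔ T (S≗S′ z))

  below-mono : ∀ {S u v} → u Fin.≤ v → below S u ≤ below S v
  below-mono {S} {u} {v} u≤v = count-mono (λ z → z <? u ×-dec z ∈? S) (λ z → z <? v ×-dec z ∈? S)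
                                          (map₁ (λ z<u → ℕ.<-≤-trans z<u u≤v))

  below-insert : ∀ {S x} v → below S v ≤ below (insert x S) v
  below-insert {S} {x} v = count-mono (λ z → z <? v ×-dec z ∈? S) (λ z → z <? v ×-dec z ∈? insert x S)
                                      (map₂ (Equivalence.from (∈-insert x S) ∘ inj₂))

  rowSum : (ValueSet n → Fin n → ℕ) → ValueSet n → (Fin k → Fin n) → ℕ
  rowSum {k = zero}  f S g = 0
  rowSum {k = suc k} f S g = f S (head g) + rowSum f (insert (head g) S) (tail g)

  rowSum-cong : ∀ f S {g h : Fin k → Fin n} → g ≗ h → rowSum f S g ≡ rowSum f S h
  rowSum-cong {k = zero}  f S g≗h = refl
  rowSum-cong {k = suc k} f S g≗h rewrite g≗h zero = cong (_ +_) (rowSum-cong f _ (g≗h ∘ suc))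

  rowSum-prefix : (f : ValueSet n → Fin n → ℕ) → (∀ {S S′} → S ≗ S′ → f S ≗ f S′) →
                  (g : Fin k → Fin n) (P : ℕ → ValueSet n) →
                  (∀ i → P (suc (toℕ i)) ≗ insert (g i) (P (toℕ i))) →
                  ∀ {S} → S ≗ P 0 → rowSum f S g ≡ sum (λ i → f (P (toℕ i)) (g i))
  rowSum-prefix {k = zero}  f f-cong g P P-suc S≗P₀ = refl
  rowSum-prefix {k = suc k} f f-cong g P P-suc S≗P₀ = cong₂ _+_ (f-cong S≗P₀ (head g))
    (rowSum-prefix f f-cong (tail g) (P ∘ suc) (P-suc ∘ suc)
                   (λ v → trans (insert-cong (head g) S≗P₀ v) (sym (P-suc zero v))))

  record Fresh (S : ValueSet n) (g : Fin k → Fin n) : Set where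
    constructor fresh
    field
      injective : Injective _≡_ _≡_ g
      avoids    : ∀ i → g i ∉ S

  module _ {S : ValueSet n} {g : Fin (suc k) → Fin n} (g-fresh : Fresh S g) where
    open Fresh g-fresh

    fresh-head : head g ∉ S
    fresh-head = avoids zero

    fresh-tail : Fresh (insert (head g) S) (tail g)
    fresh-tail = fresh (Fin.suc-injective ∘ injective) λ i →
      Sum.[ (λ eq → suc≢zero (injective eq)) , avoids (suc i) ]′ ∘ Equivalence.to (∈-insert (head g) S)
      where
      suc≢zero : ∀ {i : Fin k} → ¬ suc i ≡ zero
      suc≢zero ()

  fresh-∷ : ∀ {S y} {h : Fin k → Fin n} → y ∉ S → Fresh (insert y S) h → Fresh S (y ∷ h)
  fresh-∷ {S = S} {y} {h} y∉S (fresh h-inj h∉) = fresh injective ∉S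
    where
    h≢y : ∀ i → ¬ h i ≡ y
    h≢y i eq = h∉ i (Equivalence.from (∈-insert y S) (inj₁ eq))
    injective : Injective _≡_ _≡_ (y ∷ h)
    injective {zero}  {zero}  _  = refl
    injective {zero}  {suc j} eq = contradiction (sym eq) (h≢y j)
    injective {suc i} {zero}  eq = contradiction eq (h≢y i)
    injective {suc i} {suc j} eq = cong suc (h-inj eq)
    ∉S : ∀ i → (y ∷ h) i ∉ S
    ∉S zero    = y∉S
    ∉S (suc i) = h∉ i ∘ Equivalence.from (∈-insert y S) ∘ inj₂

-- Switching

module _ (d : ℕ) {n : ℕ} where

  Low High : ValueSet n → Fin n → Set
  Low S v  = below S v < d
  High S v = v ∉ S × ¬ Low S v

  Low? : ∀ S → Decidable (Low S)
  Low? S v = below S v ℕ.<? d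

  High? : ∀ S → Decidable (High S)
  High? S v = ¬? (v ∈? S) ×-dec ¬? (Low? S v)

  aRow bRow : ValueSet n → Fin n → ℕ
  aRow S x = countBelow (High? S) x
  bRow S y = count (λ z → ¬? (Low? S y) ×-dec (y <? z ×-dec ¬? (z ∈? S)))

  Compatible : ValueSet n → ValueSet n → Set
  Compatible S S′ = (∀ v → Low S v ⊎ Low S′ v → (v ∈ S ⇔ v ∈ S′)) × count (_∈? S) ≡ count (_∈? S′)

  Low-downward : ∀ {S u v} → u Fin.≤ v → Low S v → Low S u
  Low-downward u≤v = ℕ.≤-<-trans (below-mono u≤v)

  Low-insert⁻ : ∀ {S x v} → Low (insert x S) v → Low S v
  Low-insert⁻ {v = v} = ℕ.≤-<-trans (below-insert v)

  ¬High⇒Low : ∀ {S v} → v ∉ S → ¬ High S v → Low S v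
  ¬High⇒Low {S} {v} v∉S ¬high = decidable-stable (Low? S v) (λ ¬low → ¬high (v∉S , ¬low))

  aRow-Low : ∀ {S x} → Low S x → aRow S x ≡ 0
  aRow-Low {S} {x} low = count-none (λ z → z <? x ×-dec High? S z)
    (λ z (z<x , _ , ¬low) → ¬low (Low-downward (ℕ.<⇒≤ z<x) low))

  bRow-Low : ∀ {S y} → Low S y → bRow S y ≡ 0
  bRow-Low {S} {y} low = count-none (λ z → ¬? (Low? S y) ×-dec (y <? z ×-dec ¬? (z ∈? S)))
    (λ z (¬low , _) → ¬low low)

  bRow-High : ∀ {S y} → High S y → bRow S y ≡ countAbove (High? S) y
  bRow-High {S} {y} (_ , ¬low) = count-cong
    (λ z → ¬? (Low? S y) ×-dec (y <? z ×-dec ¬? (z ∈? S))) (λ z → y <? z ×-dec High? S z)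
    (λ z → mk⇔ (λ (_ , y<z , z∉S) → y<z , z∉S , ¬low ∘ Low-downward (ℕ.<⇒≤ y<z))
               (λ (y<z , z∉S , _) → ¬low , y<z , z∉S))

  aRow-cong : ∀ {S S′} → S ≗ S′ → aRow S ≗ aRow S′
  aRow-cong {S} {S′} S≗S′ x = count-cong
    (λ z → z <? x ×-dec High? S z) (λ z → z <? x ×-dec High? S′ z)
    (λ z → ⇔-refl ×-⇔ (¬-cong-⇔ (subst⇔ T (S≗S′ z)) ×-⇔ ¬-cong-⇔ (subst⇔ (_< d) (below-cong S≗S′ z))))

  bRow-cong : ∀ {S S′} → S ≗ S′ → bRow S ≗ bRow S′
  bRow-cong {S} {S′} S≗S′ y = count-cong
    (λ z → ¬? (Low? S y) ×-dec (y <? z ×-dec ¬? (z ∈? S)))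
    (λ z → ¬? (Low? S′ y) ×-dec (y <? z ×-dec ¬? (z ∈? S′)))
    (λ z → ¬-cong-⇔ (subst⇔ (_< d) (below-cong S≗S′ y)) ×-⇔ (⇔-refl ×-⇔ ¬-cong-⇔ (subst⇔ T (S≗S′ z))))

  compatible-sym : ∀ {S S′} → Compatible S S′ → Compatible S′ S
  compatible-sym (agree , size) = (λ v low → ⇔-sym (agree v (Sum.swap low))) , sym size

  compatible-below : ∀ {S S′ v} → Compatible S S′ → Low S v → below S v ≡ below S′ v
  compatible-below {S} {S′} {v} (agree , _) low = count-cong
    (λ z → z <? v ×-dec z ∈? S) (λ z → z <? v ×-dec z ∈? S′)
    (λ z → mk⇔ (λ (z<v , z∈S) → z<v , Equivalence.to (agree-below z<v) z∈S)
               (λ (z<v , z∈S′) → z<v , Equivalence.from (agree-below z<v) z∈S′))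
    where
    agree-below : ∀ {z} → z Fin.< v → z ∈ S ⇔ z ∈ S′
    agree-below {z} z<v = agree z (inj₁ (Low-downward (ℕ.<⇒≤ z<v) low))

  compatible-Low : ∀ {S S′ v} → Compatible S S′ → Low S v → Low S′ v
  compatible-Low S~S′ low = subst (_< d) (compatible-below S~S′ low) low

  compatible-∉ : ∀ {S S′ v} → Compatible S S′ → Low S v → v ∉ S → v ∉ S′
  compatible-∉ {v = v} (agree , _) low v∉S = v∉S ∘ Equivalence.from (agree v (inj₁ low))

  -- Both sides split the values into seen, unseen low and high ones; the first two classes match.
  compatible-#High : ∀ {S S′} → Compatible S S′ → count (High? S) ≡ count (High? S′)
  compatible-#High {S} {S′} S~S′ = ℕ.+-cancelˡ-≡ (count (unseenLow? S)) _ _ (begin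
    count (unseenLow? S) + count (High? S)    ≡⟨ count-partition (λ v → ¬? (v ∈? S)) (Low? S) ⟨
    count (λ v → ¬? (v ∈? S))                 ≡⟨ ℕ.+-cancelˡ-≡ (count (_∈? S)) _ _ equal-size ⟩
    count (λ v → ¬? (v ∈? S′))                ≡⟨ count-partition (λ v → ¬? (v ∈? S′)) (Low? S′) ⟩
    count (unseenLow? S′) + count (High? S′)  ≡⟨ cong (_+ _) unseenLow≡ ⟨
    count (unseenLow? S) + count (High? S′)   ∎)
    where
    open ≡-Reasoning
    unseenLow? : ∀ S → Decidable (λ v → v ∉ S × Low S v)
    unseenLow? S v = ¬? (v ∈? S) ×-dec Low? S v
    equal-size : count (_∈? S) + count (λ v → ¬? (v ∈? S)) ≡ count (_∈? S) + count (λ v → ¬? (v ∈? S′))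
    equal-size = trans (count-complement (_∈? S))
                       (sym (trans (cong (_+ _) (proj₂ S~S′)) (count-complement (_∈? S′))))
    unseenLow≡ : count (unseenLow? S) ≡ count (unseenLow? S′)
    unseenLow≡ = count-cong (unseenLow? S) (unseenLow? S′) λ v → mk⇔
      (λ (v∉S , low) → compatible-∉ S~S′ low v∉S , compatible-Low S~S′ low)
      (λ (v∉S′ , low) → compatible-∉ S′~S low v∉S′ , compatible-Low S′~S low)
      where
      S′~S : Compatible S′ S
      S′~S = compatible-sym S~S′

  compatible-insert : ∀ {S S′ x y} → Compatible S S′ → x ∉ S → y ∉ S′ →
                      (∀ v → Low S v ⊎ Low S′ v → (v ≡ x ⇔ v ≡ y)) →
                      Compatible (insert x S) (insert y S′)
  compatible-insert {S} {S′} {x} {y} (agree , size) x∉S y∉S′ x~y = agree′ , size′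
    where
    agree′ : ∀ v → Low (insert x S) v ⊎ Low (insert y S′) v → (v ∈ insert x S ⇔ v ∈ insert y S′)
    agree′ v low = ⇔-trans (∈-insert x S) (⇔-trans (x~y v low′ ⊎-⇔ agree v low′) (⇔-sym (∈-insert y S′)))
      where
      low′ : Low S v ⊎ Low S′ v
      low′ = Sum.map Low-insert⁻ Low-insert⁻ low
    size′ : count (_∈? insert x S) ≡ count (_∈? insert y S′)
    size′ = begin
      count (_∈? insert x S)  ≡⟨ count-insert (_∈? S) (_∈? insert x S) x∉S (λ _ → ∈-insert x S) ⟩
      suc (count (_∈? S))     ≡⟨ cong suc size ⟩
      suc (count (_∈? S′))    ≡⟨ count-insert (_∈? S′) (_∈? insert y S′) y∉S′ (λ _ → ∈-insert y S′) ⟨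
      count (_∈? insert y S′) ∎
      where open ≡-Reasoning

  -- The default x is never returned when Compatible S S′ holds (see stepView).
  step : ValueSet n → ValueSet n → Fin n → Fin n
  step S S′ x with High? S x
  ... | yes _ = select (λ y → High? S′ y ×-dec countAbove (High? S′) y ℕ.≟ aRow S x) x
  ... | no _  = x

  data StepView (S S′ : ValueSet n) (x : Fin n) : Fin n → Set where
    switched : ∀ {y} → High S x → High S′ y → countAbove (High? S′) y ≡ aRow S x → StepView S S′ x y
    kept     : ¬ High S x → StepView S S′ x x

  stepView : ∀ {S S′} → Compatible S S′ → ∀ x → StepView S S′ x (step S S′ x)
  stepView {S} {S′} S~S′ x with High? S x
  ... | no ¬high = kept ¬high
  ... | yes high = switched high (proj₁ selected) (proj₂ selected)
    where
    aRow<#High : aRow S x < count (High? S′)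
    aRow<#High = subst (aRow S x <_) (trans (sym (count-split (High? S) high)) (compatible-#High S~S′))
                       (ℕ.m<m+n (aRow S x) (s≤s z≤n))
    matching? : Decidable (λ y → High S′ y × countAbove (High? S′) y ≡ aRow S x)
    matching? y = High? S′ y ×-dec countAbove (High? S′) y ℕ.≟ aRow S x
    selected : High S′ (select matching? x) × countAbove (High? S′) (select matching? x) ≡ aRow S x
    selected = select-sound matching? (proj₂ (countAbove-surjective (High? S′) aRow<#High))

  module _ {S S′ : ValueSet n} (S~S′ : Compatible S S′) {x : Fin n} (x∉S : x ∉ S) where

    private
      low-kept : ¬ High S x → Low S x
      low-kept = ¬High⇒Low x∉S

      low-both : ∀ {v} → Low S v ⊎ Low S′ v → Low S v × Low S′ v
      low-both = Sum.[ (λ low → low , compatible-Low S~S′ low)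
                     , (λ low′ → compatible-Low (compatible-sym S~S′) low′ , low′) ]′

    step-∉ : step S S′ x ∉ S′
    step-∉ with step S S′ x | stepView S~S′ x
    ... | _ | switched _ (y∉S′ , _) _ = y∉S′
    ... | _ | kept ¬high              = compatible-∉ S~S′ (low-kept ¬high) x∉S

    step-involutive : step S′ S (step S S′ x) ≡ x
    step-involutive with step S S′ x | stepView S~S′ x
    ... | _ | kept ¬high with step S′ S x | stepView (compatible-sym S~S′) x
    ...   | _ | switched high′ _ _ = contradiction (compatible-Low S~S′ (low-kept ¬high)) (proj₂ high′)
    ...   | _ | kept _             = refl
    step-involutive | y | switched high high′ above≡
      with step S′ S y | stepView (compatible-sym S~S′) y
    ...   | _ | kept ¬high′               = contradiction high′ ¬high′
    ...   | _ | switched _ high″ above≡′ =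
      countAbove-injective (High? S) high″ high (trans above≡′ below≡above)
      where
      below≡above : aRow S′ y ≡ countAbove (High? S) x
      below≡above = +-suc-swap (begin
        aRow S x + suc (countAbove (High? S) x)  ≡⟨ count-split (High? S) high ⟨
        count (High? S)                          ≡⟨ compatible-#High S~S′ ⟩
        count (High? S′)                         ≡⟨ count-split (High? S′) high′ ⟩
        aRow S′ y + suc (countAbove (High? S′) y) ≡⟨ cong (λ r → aRow S′ y + suc r) above≡ ⟩
        aRow S′ y + suc (aRow S x)               ∎)
        where
        open ≡-Reasoning
        +-suc-swap : ∀ {a b c} → a + suc b ≡ c + suc a → c ≡ b
        +-suc-swap {a} {b} {c} eq = sym (ℕ.+-cancelʳ-≡ a b c (ℕ.suc-injective (begin
          suc (b + a) ≡⟨ cong suc (ℕ.+-comm b a) ⟩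
          suc (a + b) ≡⟨ ℕ.+-suc a b ⟨
          a + suc b   ≡⟨ eq ⟩
          c + suc a   ≡⟨ ℕ.+-suc c a ⟩
          suc (c + a) ∎)))

    step-compatible : Compatible (insert x S) (insert (step S S′ x) S′)
    step-compatible with step S S′ x | stepView S~S′ x | step-∉
    ... | _ | kept _ | x∉S′ = compatible-insert S~S′ x∉S x∉S′ (λ _ _ → ⇔-refl)
    ... | y | switched high high′ _ | y∉S′ = compatible-insert S~S′ x∉S y∉S′ λ v low →
      let low , low′ = low-both low
      in mk⇔ (λ { refl → contradiction low (proj₂ high) })
             (λ { refl → contradiction low′ (proj₂ high′) })

    aRow≡bRow : aRow S x ≡ bRow S′ (step S S′ x)
    aRow≡bRow with step S S′ x | stepView S~S′ x
    ... | _ | switched _ high′ above≡ = trans (sym above≡) (sym (bRow-High high′))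
    ... | _ | kept ¬high              =
      trans (aRow-Low (low-kept ¬high)) (sym (bRow-Low (compatible-Low S~S′ (low-kept ¬high))))

  run : ValueSet n → ValueSet n → (Fin k → Fin n) → Fin k → Fin n
  run {k = zero}  S S′ g ()
  run {k = suc k} S S′ g = y ∷ run (insert (head g) S) (insert y S′) (tail g)
    where
    y : Fin n
    y = step S S′ (head g)

  run-cong : ∀ S S′ {g h : Fin k → Fin n} → g ≗ h → run S S′ g ≗ run S S′ h
  run-cong S S′ g≗h zero    = cong (step S S′) (g≗h zero)
  run-cong S S′ {g} g≗h (suc i) rewrite g≗h zero = run-cong _ _ (g≗h ∘ suc) i

  run-fresh : ∀ {S S′} {g : Fin k → Fin n} → Compatible S S′ → Fresh S g → Fresh S′ (run S S′ g)
  run-fresh {k = zero}  _    _       = fresh (λ { {()} }) λ ()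
  run-fresh {k = suc k} S~S′ g-fresh = fresh-∷ (step-∉ S~S′ (fresh-head g-fresh))
    (run-fresh (step-compatible S~S′ (fresh-head g-fresh)) (fresh-tail g-fresh))

  run-involutive : ∀ {S S′} {g : Fin k → Fin n} → Compatible S S′ → Fresh S g →
                   run S′ S (run S S′ g) ≗ g
  run-involutive S~S′ g-fresh zero = step-involutive S~S′ (fresh-head g-fresh)
  run-involutive {S = S} {S′} {g} S~S′ g-fresh (suc i) = trans
    (cong (λ x → run (insert y S′) (insert x S) (run (insert (head g) S) (insert y S′) (tail g)) i)
          (step-involutive S~S′ (fresh-head g-fresh)))
    (run-involutive (step-compatible S~S′ (fresh-head g-fresh)) (fresh-tail g-fresh) i)
    where
    y : Fin n
    y = step S S′ (head g)

  run-rowSum : ∀ {S S′} {g : Fin k → Fin n} → Compatible S S′ → Fresh S g →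
               rowSum aRow S g ≡ rowSum bRow S′ (run S S′ g)
  run-rowSum {k = zero}  _    _       = refl
  run-rowSum {k = suc k} S~S′ g-fresh = cong₂ _+_ (aRow≡bRow S~S′ (fresh-head g-fresh))
    (run-rowSum (step-compatible S~S′ (fresh-head g-fresh)) (fresh-tail g-fresh))


-- Rows of final pairs

module _ {n : ℕ} (π : Permutation′ n) where

  prefix : ℕ → ValueSet n
  prefix i v = toℕ (π ⟨$⟩ˡ v) ℕ.<ᵇ i

  ∈-prefix : ∀ {i v} → v ∈ prefix i ⇔ toℕ (π ⟨$⟩ˡ v) < i
  ∈-prefix = mk⇔ (ℕ.<ᵇ⇒< _ _) ℕ.<⇒<ᵇ

  ∈-prefix-π : ∀ {i j : Fin n} → π ⟨$⟩ʳ j ∈ prefix (toℕ i) ⇔ j Fin.< i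
  ∈-prefix-π {i} = ⇔-trans ∈-prefix (subst⇔ (_< toℕ i) (cong toℕ (inverseˡ π)))

  prefix-zero : ∅ ≗ prefix 0
  prefix-zero v = refl

  prefix-suc : ∀ i → prefix (suc (toℕ i)) ≗ insert (π ⟨$⟩ʳ i) (prefix (toℕ i))
  prefix-suc i v = does-⇔ (mk⇔ split join) (toℕ (π ⟨$⟩ˡ v) ℕ.<? suc (toℕ i))
                                           (v ≟ π ⟨$⟩ʳ i ⊎-dec toℕ (π ⟨$⟩ˡ v) ℕ.<? toℕ i)
    where
    split : toℕ (π ⟨$⟩ˡ v) < suc (toℕ i) → v ≡ π ⟨$⟩ʳ i ⊎ toℕ (π ⟨$⟩ˡ v) < toℕ i
    split lt = Sum.map (λ eq → trans (sym (inverseʳ π)) (cong (π ⟨$⟩ʳ_) (toℕ-injective eq))) id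
                       (Sum.swap (ℕ.m<1+n⇒m<n∨m≡n lt))
    join : v ≡ π ⟨$⟩ʳ i ⊎ toℕ (π ⟨$⟩ˡ v) < toℕ i → toℕ (π ⟨$⟩ˡ v) < suc (toℕ i)
    join (inj₁ refl) = subst (λ j → toℕ j < suc (toℕ i)) (sym (inverseˡ π)) (ℕ.n<1+n (toℕ i))
    join (inj₂ lt)   = ℕ.m<n⇒m<1+n lt

  earlierBelow : Fin n → Fin n → ℕ
  earlierBelow i w = count (λ l → l <? i ×-dec π ⟨$⟩ʳ l <? w)

  earlierBelow≡below : ∀ i w → earlierBelow i w ≡ below (prefix (toℕ i)) w
  earlierBelow≡below i w = trans
    (count-cong (λ l → l <? i ×-dec π ⟨$⟩ʳ l <? w) (λ l → π ⟨$⟩ʳ l <? w ×-dec π ⟨$⟩ʳ l ∈? prefix (toℕ i))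
                (λ l → mk⇔ (λ (l<i , lt) → lt , Equivalence.from ∈-prefix-π l<i)
                           (λ (lt , l∈) → Equivalence.to ∈-prefix-π l∈ , lt)))
    (count-permute π (λ v → v <? w ×-dec v ∈? prefix (toℕ i)))

module _ (d : ℕ) {n : ℕ} (π : Permutation′ n) where

  private
    π[_] : Fin n → Fin n
    π[_] = π ⟨$⟩ʳ_

  FinalA FinalB : Fin n × Fin n → Set
  FinalA (i , j) = i Fin.< j × π[ j ] Fin.< π[ i ] × d ≤ earlierBelow π i π[ j ]
  FinalB (i , j) = i Fin.< j × π[ i ] Fin.< π[ j ] × d ≤ earlierBelow π i π[ i ]

  FinalA? : Decidable FinalA
  FinalA? (i , j) = i <? j ×-dec π[ j ] <? π[ i ] ×-dec d ℕ.≤? earlierBelow π i π[ j ]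

  FinalB? : Decidable FinalB
  FinalB? (i , j) = i <? j ×-dec π[ i ] <? π[ j ] ×-dec d ℕ.≤? earlierBelow π i π[ i ]

  private
    module _ (i : Fin n) where

      seen : ValueSet n
      seen = prefix π (toℕ i)

      d≤earlierBelow⇔¬Low : ∀ w → d ≤ earlierBelow π i w ⇔ (¬ Low d seen w)
      d≤earlierBelow⇔¬Low w =
        ⇔-trans (mk⇔ ℕ.≤⇒≯ ℕ.≮⇒≥) (¬-cong-⇔ (subst⇔ (_< d) (earlierBelow≡below π i w)))

      later⇔∉ : ∀ {j} → π[ j ] ≢ π[ i ] → i Fin.< j ⇔ π[ j ] ∉ seen
      later⇔∉ {j} πj≢πi = mk⇔
        (λ i<j j∈S → ℕ.<-asym i<j (Equivalence.to (∈-prefix-π π) j∈S))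
        (λ j∉S → ℕ.≤∧≢⇒< (ℕ.≮⇒≥ (j∉S ∘ Equivalence.from (∈-prefix-π π)))
                          (πj≢πi ∘ sym ∘ cong π[_] ∘ toℕ-injective))

  rowA≡aRow : ∀ i → count (λ j → FinalA? (i , j)) ≡ aRow d (prefix π (toℕ i)) π[ i ]
  rowA≡aRow i = trans (count-cong (λ j → FinalA? (i , j)) (R? ∘ π[_]) λ j → mk⇔
      (λ (i<j , πj<πi , enough) → πj<πi , Equivalence.to (later⇔∉ i (Fin.<⇒≢ πj<πi)) i<j
                                , Equivalence.to (d≤earlierBelow⇔¬Low i π[ j ]) enough)
      (λ (πj<πi , j∉S , ¬low) → Equivalence.from (later⇔∉ i (Fin.<⇒≢ πj<πi)) j∉S , πj<πi
                              , Equivalence.from (d≤earlierBelow⇔¬Low i π[ j ]) ¬low))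
    (count-permute π R?)
    where
    R? : Decidable (λ z → z Fin.< π[ i ] × High d (seen i) z)
    R? z = z <? π[ i ] ×-dec High? d (seen i) z

  rowB≡bRow : ∀ i → count (λ j → FinalB? (i , j)) ≡ bRow d (prefix π (toℕ i)) π[ i ]
  rowB≡bRow i = trans (count-cong (λ j → FinalB? (i , j)) (R? ∘ π[_]) λ j → mk⇔
      (λ (i<j , πi<πj , enough) → Equivalence.to (d≤earlierBelow⇔¬Low i π[ i ]) enough , πi<πj
                                , Equivalence.to (later⇔∉ i (≢-sym (Fin.<⇒≢ πi<πj))) i<j)
      (λ (¬low , πi<πj , j∉S) → Equivalence.from (later⇔∉ i (≢-sym (Fin.<⇒≢ πi<πj))) j∉S , πi<πj
                              , Equivalence.from (d≤earlierBelow⇔¬Low i π[ i ]) ¬low))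
    (count-permute π R?)
    where
    R? : Decidable (λ z → ¬ Low d (seen i) π[ i ] × π[ i ] Fin.< z × z ∉ seen i)
    R? z = ¬? (Low? d (seen i) π[ i ]) ×-dec (π[ i ] <? z ×-dec ¬? (z ∈? seen i))

HasCard⇔rowSum : ∀ {n} (π : Permutation′ n) {F : Pred (Fin n × Fin n) 0ℓ} (F? : Decidable F) →
                 ∀ {f} → (∀ {S S′} → S ≗ S′ → f S ≗ f S′) →
                 (∀ i → count (λ j → F? (i , j)) ≡ f (prefix π (toℕ i)) (π ⟨$⟩ʳ i)) →
                 ∀ {k} → HasCard k F ⇔ k ≡ rowSum f ∅ (π ⟨$⟩ʳ_)
HasCard⇔rowSum π F? {f} f-cong row≡ =
  ⇔-trans (HasCard-pairs F?) (mk⇔ (flip trans sum≡) (flip trans (sym sum≡)))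
  where
  sum≡ : sum (λ i → count (λ j → F? (i , j))) ≡ rowSum f ∅ (π ⟨$⟩ʳ_)
  sum≡ = trans (sum-cong-≗ row≡)
               (sym (rowSum-prefix f f-cong (π ⟨$⟩ʳ_) (prefix π) (prefix-suc π) (prefix-zero π)))

-- Occurrences ending in the two largest values

module _ {d : ℕ} where

  private
    m : ℕ
    m = suc (suc d)

  position : (x : Fin m) → toℕ x < d ⊎ toℕ x ≡ d ⊎ toℕ x ≡ suc d
  position x with ℕ.<-cmp (toℕ x) d
  ... | tri< x<d _ _ = inj₁ x<d
  ... | tri≈ _ x≡d _ = inj₂ (inj₁ x≡d)
  ... | tri> _ _ d<x = inj₂ (inj₂ (ℕ.≤-antisym (ℕ.≤-pred (toℕ<n x)) d<x))

  front : Fin d → Fin m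
  front = Fin.inject₁ ∘ Fin.inject₁

  toℕ-front : ∀ t → toℕ (front t) ≡ toℕ t
  toℕ-front t = trans (Fin.toℕ-inject₁ (Fin.inject₁ t)) (Fin.toℕ-inject₁ t)

  penult ult : Fin m
  penult = fromℕ< (ℕ.m<n⇒m<1+n (ℕ.n<1+n d))
  ult    = fromℕ< (ℕ.n<1+n (suc d))

  toℕ-penult : toℕ penult ≡ d
  toℕ-penult = toℕ-fromℕ< (ℕ.m<n⇒m<1+n (ℕ.n<1+n d))

  toℕ-ult : toℕ ult ≡ suc d
  toℕ-ult = toℕ-fromℕ< (ℕ.n<1+n (suc d))

  ≡penult : ∀ {x} → toℕ x ≡ d → x ≡ penult
  ≡penult x≡d = toℕ-injective (trans x≡d (sym toℕ-penult))

  ≡ult : ∀ {x} → toℕ x ≡ suc d → x ≡ ult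
  ≡ult x≡1+d = toℕ-injective (trans x≡1+d (sym toℕ-ult))

  front-penult-ult : ∀ y → toℕ y < d ⊎ y ≡ penult ⊎ y ≡ ult
  front-penult-ult y = Sum.map₂ (Sum.map ≡penult ≡ult) (position y)

  d≤penult : d ≤ toℕ penult
  d≤penult = ℕ.≤-reflexive (sym toℕ-penult)

  d≤ult : d ≤ toℕ ult
  d≤ult = subst (d ≤_) (sym toℕ-ult) (ℕ.n≤1+n d)

  module _ (τ : Permutation′ m) {p q : Fin m} (τp≡d : toℕ (τ ⟨$⟩ʳ p) ≡ d)
           (τq≡1+d : toℕ (τ ⟨$⟩ʳ q) ≡ suc d) (d≤p : d ≤ toℕ p) (d≤q : d ≤ toℕ q) where

    private
      not-front : ∀ {x y} → toℕ (τ ⟨$⟩ʳ x) ≡ toℕ (τ ⟨$⟩ʳ y) → d ≤ toℕ y → ¬ toℕ x < d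
      not-front τx≡τy d≤y =
        ℕ.≤⇒≯ (subst (λ z → d ≤ toℕ z) (⟨$⟩ʳ-injective τ (toℕ-injective (sym τx≡τy))) d≤y)

    front-values : ∀ x → toℕ x < d → toℕ (τ ⟨$⟩ʳ x) < d
    front-values x x<d with position (τ ⟨$⟩ʳ x)
    ... | inj₁ τx<d          = τx<d
    ... | inj₂ (inj₁ τx≡d)   = contradiction x<d (not-front (trans τx≡d (sym τp≡d)) d≤p)
    ... | inj₂ (inj₂ τx≡1+d) = contradiction x<d (not-front (trans τx≡1+d (sym τq≡1+d)) d≤q)

module _ {d n : ℕ} (π : Permutation′ n) where

  private
    m : ℕ
    m = suc (suc d)
    π[_] : Fin n → Fin n
    π[_] = π ⟨$⟩ʳ_

  occurrence⇒Final : ∀ {τ f} → IsOccurrence τ π f →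
                     ∀ {p q} → toℕ (τ ⟨$⟩ʳ p) ≡ d → toℕ (τ ⟨$⟩ʳ q) ≡ suc d → d ≤ toℕ p → d ≤ toℕ q →
                     π[ f p ] Fin.< π[ f q ] × d ≤ earlierBelow π (f penult) π[ f p ]
  occurrence⇒Final {τ} {f} (f-mono , f-order) {p} {q} τp≡d τq≡1+d d≤p d≤q =
    Equivalence.from (f-order p q) (subst₂ _<_ (sym τp≡d) (sym τq≡1+d) (ℕ.n<1+n d)) ,
    HasCard-≤ (f ∘ front) (strictMono⇒injective (f-mono _ _ ∘ front-<)) (λ t → earlier t , smaller t)
              (count-HasCard (λ l → l <? f penult ×-dec π[ l ] <? π[ f p ]))
    where
    front-< : ∀ {s t} → s Fin.< t → front s Fin.< front t
    front-< = subst₂ _<_ (sym (toℕ-front _)) (sym (toℕ-front _))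
    front<d : ∀ t → toℕ (front t) < d
    front<d t = subst (_< d) (sym (toℕ-front t)) (toℕ<n t)
    earlier : ∀ t → f (front t) Fin.< f penult
    earlier t = f-mono (front t) penult (subst (toℕ (front t) <_) (sym toℕ-penult) (front<d t))
    smaller : ∀ t → π[ f (front t) ] Fin.< π[ f p ]
    smaller t = Equivalence.from (f-order (front t) p) (subst (toℕ (τ ⟨$⟩ʳ front t) <_) (sym τp≡d)
      (front-values τ τp≡d τq≡1+d d≤p d≤q (front t) (front<d t)))

  module Embedding {i j w : Fin n} (i<j : i Fin.< j) (enough : d ≤ earlierBelow π i w) where

    private
      L? : Decidable (λ l → l Fin.< i × π[ l ] Fin.< w)
      L? l = l <? i ×-dec π[ l ] <? w

    embed : Fin m → Fin n
    embed x with position x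
    ... | inj₁ x<d      = enum L? (fromℕ< (ℕ.<-≤-trans x<d enough))
    ... | inj₂ (inj₁ _) = i
    ... | inj₂ (inj₂ _) = j

    embed-front : ∀ x → toℕ x < d → embed x Fin.< i × π[ embed x ] Fin.< w
    embed-front x x<d with position x
    ... | inj₁ _            = enum-sound L? _
    ... | inj₂ (inj₁ x≡d)   = contradiction x≡d (ℕ.<⇒≢ x<d)
    ... | inj₂ (inj₂ x≡1+d) = contradiction x<d (ℕ.≤⇒≯ (subst (d ≤_) (sym x≡1+d) (ℕ.n≤1+n d)))

    embed-penult : ∀ x → toℕ x ≡ d → embed x ≡ i
    embed-penult x x≡d with position x
    ... | inj₁ x<d          = contradiction x≡d (ℕ.<⇒≢ x<d)
    ... | inj₂ (inj₁ _)     = refl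
    ... | inj₂ (inj₂ x≡1+d) = contradiction (trans (sym x≡d) x≡1+d) (ℕ.<⇒≢ (ℕ.n<1+n d))

    embed-ult : ∀ x → toℕ x ≡ suc d → embed x ≡ j
    embed-ult x x≡1+d with position x
    ... | inj₁ x<d        = contradiction x≡1+d (ℕ.<⇒≢ (ℕ.m<n⇒m<1+n x<d))
    ... | inj₂ (inj₁ x≡d) = contradiction (trans (sym x≡d) x≡1+d) (ℕ.<⇒≢ (ℕ.n<1+n d))
    ... | inj₂ (inj₂ _)   = refl

    embed-strictMono : ∀ x y → x Fin.< y → embed x Fin.< embed y
    embed-strictMono x y x<y with position x | position y
    ... | inj₁ _ | inj₁ _ =
      enum-strictMono L? (subst₂ _<_ (sym (toℕ-fromℕ< _)) (sym (toℕ-fromℕ< _)) x<y)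
    ... | inj₁ _ | inj₂ (inj₁ _)        = proj₁ (enum-sound L? _)
    ... | inj₁ _ | inj₂ (inj₂ _)        = Fin.<-trans (proj₁ (enum-sound L? _)) i<j
    ... | inj₂ (inj₁ _) | inj₂ (inj₂ _) = i<j
    ... | inj₂ (inj₁ x≡d) | inj₁ y<d =
      contradiction x<y (ℕ.<-asym (subst (toℕ y <_) (sym x≡d) y<d))
    ... | inj₂ (inj₁ x≡d) | inj₂ (inj₁ y≡d) =
      contradiction (trans x≡d (sym y≡d)) (ℕ.<⇒≢ x<y)
    ... | inj₂ (inj₂ x≡1+d) | inj₁ y<d =
      contradiction x<y (ℕ.<-asym (subst (toℕ y <_) (sym x≡1+d) (ℕ.m<n⇒m<1+n y<d)))
    ... | inj₂ (inj₂ x≡1+d) | inj₂ (inj₁ y≡d) =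
      contradiction x<y (ℕ.<-asym (subst₂ _<_ (sym y≡d) (sym x≡1+d) (ℕ.n<1+n d)))
    ... | inj₂ (inj₂ x≡1+d) | inj₂ (inj₂ y≡1+d) =
      contradiction (trans x≡1+d (sym y≡1+d)) (ℕ.<⇒≢ x<y)

    values : Fin m → Fin n
    values = π[_] ∘ embed

    values-injective : Injective _≡_ _≡_ values
    values-injective eq = strictMono⇒injective (embed-strictMono _ _) (⟨$⟩ʳ-injective π eq)

    τ : Permutation′ m
    τ = standardise values values-injective

    occurrence : IsOccurrence τ π embed
    occurrence = embed-strictMono , λ x y → ⇔-sym (standardise-< values values-injective x y)

    module _ {p q : Fin m} (cover : ∀ y → toℕ y < d ⊎ y ≡ p ⊎ y ≡ q)
             (values-p : values p ≡ w) (p<q : values p Fin.< values q) where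

      private
        below-p : ∀ y → toℕ y < d → values y Fin.< values p
        below-p y y<d = subst (values y Fin.<_) (sym values-p) (proj₂ (embed-front y y<d))

      τ-smaller : toℕ (τ ⟨$⟩ʳ p) ≡ d
      τ-smaller = trans (toℕ-standardise values values-injective p) (trans
        (count-cong (λ y → values y <? values p) (λ y → toℕ y ℕ.<? d)
                    (λ y → mk⇔ (front-position y) (below-p y)))
        (count-toℕ< (ℕ.≤-trans (ℕ.n≤1+n d) (ℕ.n≤1+n (suc d)))))
        where
        front-position : ∀ y → values y Fin.< values p → toℕ y < d
        front-position y lt with cover y
        ... | inj₁ y<d         = y<d
        ... | inj₂ (inj₁ refl) = contradiction lt (ℕ.<-irrefl refl)
        ... | inj₂ (inj₂ refl) = contradiction lt (ℕ.<-asym p<q)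

      τ-larger : toℕ (τ ⟨$⟩ʳ q) ≡ suc d
      τ-larger = trans (toℕ-standardise values values-injective q) (trans
        (count-cong (λ y → values y <? values q) (λ y → ¬? (y ≟ q)) (λ y → mk⇔ (other y) (below-q y)))
        (count-≢ q))
        where
        other : ∀ y → values y Fin.< values q → y ≢ q
        other y lt refl = ℕ.<-irrefl refl lt
        below-q : ∀ y → y ≢ q → values y Fin.< values q
        below-q y y≢q with cover y
        ... | inj₁ y<d         = Fin.<-trans (below-p y y<d) p<q
        ... | inj₂ (inj₁ refl) = p<q
        ... | inj₂ (inj₂ y≡q)  = contradiction y≡q y≢q

  FinalPair⇔FinalA : ∀ {i j} → FinalPair m (InA m) π (i , j) ⇔ FinalA d π (i , j)
  FinalPair⇔FinalA = mk⇔ to from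
    where
    to : ∀ {i j} → FinalPair m (InA m) π (i , j) → FinalA d π (i , j)
    to (i<j , τ , (τ-penult , τ-ult) , f , occ , f-penult , f-ult)
      with f-penult penult toℕ-penult | f-ult ult toℕ-ult
    ... | refl | refl =
      i<j , occurrence⇒Final {τ} {f} occ (τ-ult ult toℕ-ult) (τ-penult penult toℕ-penult) d≤ult d≤penult
    from : ∀ {i j} → FinalA d π (i , j) → FinalPair m (InA m) π (i , j)
    from {i} {j} (i<j , descent , enough) =
      i<j , τ , (at-penult , at-ult) , embed , occurrence , embed-penult , embed-ult
      where
      open Embedding i<j enough
      values-ult : values ult ≡ π[ j ]
      values-ult = cong π[_] (embed-ult ult toℕ-ult)
      ult<penult : values ult Fin.< values penult
      ult<penult = subst₂ Fin._<_ (sym values-ult) (sym (cong π[_] (embed-penult penult toℕ-penult)))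
                          descent
      cover : ∀ y → toℕ y < d ⊎ y ≡ ult ⊎ y ≡ penult
      cover = Sum.map₂ Sum.swap ∘ front-penult-ult
      at-penult : ∀ x → toℕ x ≡ d → toℕ (τ ⟨$⟩ʳ x) ≡ suc d
      at-penult x x≡d rewrite ≡penult x≡d = τ-larger cover values-ult ult<penult
      at-ult : ∀ x → toℕ x ≡ suc d → toℕ (τ ⟨$⟩ʳ x) ≡ d
      at-ult x x≡1+d rewrite ≡ult x≡1+d = τ-smaller cover values-ult ult<penult

  FinalPair⇔FinalB : ∀ {i j} → FinalPair m (InB m) π (i , j) ⇔ FinalB d π (i , j)
  FinalPair⇔FinalB = mk⇔ to from
    where
    to : ∀ {i j} → FinalPair m (InB m) π (i , j) → FinalB d π (i , j)
    to (i<j , τ , (τ-penult , τ-ult) , f , occ , f-penult , f-ult)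
      with f-penult penult toℕ-penult | f-ult ult toℕ-ult
    ... | refl | refl =
      i<j , occurrence⇒Final {τ} {f} occ (τ-penult penult toℕ-penult) (τ-ult ult toℕ-ult) d≤penult d≤ult
    from : ∀ {i j} → FinalB d π (i , j) → FinalPair m (InB m) π (i , j)
    from {i} {j} (i<j , ascent , enough) =
      i<j , τ , (at-penult , at-ult) , embed , occurrence , embed-penult , embed-ult
      where
      open Embedding i<j enough
      values-penult : values penult ≡ π[ i ]
      values-penult = cong π[_] (embed-penult penult toℕ-penult)
      penult<ult : values penult Fin.< values ult
      penult<ult = subst₂ Fin._<_ (sym values-penult) (sym (cong π[_] (embed-ult ult toℕ-ult)))
                          ascent
      at-penult : ∀ x → toℕ x ≡ d → toℕ (τ ⟨$⟩ʳ x) ≡ d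
      at-penult x x≡d rewrite ≡penult x≡d = τ-smaller front-penult-ult values-penult penult<ult
      at-ult : ∀ x → toℕ x ≡ suc d → toℕ (τ ⟨$⟩ʳ x) ≡ suc d
      at-ult x x≡1+d rewrite ≡ult x≡1+d = τ-larger front-penult-ult values-penult penult<ult

-- The involution

module _ (d : ℕ) {n : ℕ} where

  private
    m : ℕ
    m = suc (suc d)

    ∅~∅ : Compatible d {n} ∅ ∅
    ∅~∅ = (λ _ _ → ⇔-refl) , refl

    fresh-π : ∀ (π : Permutation′ n) → Fresh ∅ (π ⟨$⟩ʳ_)
    fresh-π π = fresh (⟨$⟩ʳ-injective π) (λ _ ())

  a≡⇔rowSum : ∀ (π : Permutation′ n) {k} → a≡ m π k ⇔ k ≡ rowSum (aRow d) ∅ (π ⟨$⟩ʳ_)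
  a≡⇔rowSum π = ⇔-trans (HasCard-cong (λ _ → FinalPair⇔FinalA π))
                        (HasCard⇔rowSum π (FinalA? d π) (aRow-cong d) (rowA≡aRow d π))

  b≡⇔rowSum : ∀ (π : Permutation′ n) {k} → b≡ m π k ⇔ k ≡ rowSum (bRow d) ∅ (π ⟨$⟩ʳ_)
  b≡⇔rowSum π = ⇔-trans (HasCard-cong (λ _ → FinalPair⇔FinalB π))
                        (HasCard⇔rowSum π (FinalB? d π) (bRow-cong d) (rowB≡bRow d π))

  Φ : Permutation′ n → Permutation′ n
  Φ π = injective⇒permutation (run d ∅ ∅ (π ⟨$⟩ʳ_)) (Fresh.injective (run-fresh d ∅~∅ (fresh-π π)))

  Φ-cong : ∀ π ρ → (∀ i → π ⟨$⟩ʳ i ≡ ρ ⟨$⟩ʳ i) → ∀ i → Φ π ⟨$⟩ʳ i ≡ Φ ρ ⟨$⟩ʳ i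
  Φ-cong π ρ = run-cong d ∅ ∅

  Φ-involutive : ∀ (π : Permutation′ n) i → Φ (Φ π) ⟨$⟩ʳ i ≡ π ⟨$⟩ʳ i
  Φ-involutive π = run-involutive d ∅~∅ (fresh-π π)

  a≡⇒b≡Φ : ∀ {k} π → a≡ m π k → b≡ m (Φ π) k
  a≡⇒b≡Φ π a≡k = Equivalence.from (b≡⇔rowSum (Φ π))
    (trans (Equivalence.to (a≡⇔rowSum π) a≡k) (run-rowSum d ∅~∅ (fresh-π π)))

  b≡⇒a≡Φ : ∀ {k} σ → b≡ m σ k → a≡ m (Φ σ) k
  b≡⇒a≡Φ {k} σ b≡k = Equivalence.from (a≡⇔rowSum (Φ σ)) (begin
    k                                   ≡⟨ Equivalence.to (b≡⇔rowSum σ) b≡k ⟩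
    rowSum (bRow d) ∅ (σ ⟨$⟩ʳ_)         ≡⟨ rowSum-cong (bRow d) ∅ (Φ-involutive σ) ⟨
    rowSum (bRow d) ∅ (Φ (Φ σ) ⟨$⟩ʳ_)   ≡⟨ run-rowSum d ∅~∅ (fresh-π (Φ σ)) ⟨
    rowSum (aRow d) ∅ (Φ σ ⟨$⟩ʳ_)       ∎)
    where open ≡-Reasoning

involution⇒Inverse : ∀ {n} {P Q : Permutation′ n → Set} (f : Permutation′ n → Permutation′ n) →
  (∀ π ρ → (∀ i → π ⟨$⟩ʳ i ≡ ρ ⟨$⟩ʳ i) → ∀ i → f π ⟨$⟩ʳ i ≡ f ρ ⟨$⟩ʳ i) →
  (∀ π i → f (f π) ⟨$⟩ʳ i ≡ π ⟨$⟩ʳ i) →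
  (∀ π → P π → Q (f π)) → (∀ π → Q π → P (f π)) →
  Inverse (PermSetoid n P) (PermSetoid n Q)
involution⇒Inverse f f-cong f-involutive P⇒Q Q⇒P = record
  { to        = λ (π , p) → f π , P⇒Q π p
  ; from      = λ (π , q) → f π , Q⇒P π q
  ; to-cong   = λ {(π , _)} {(ρ , _)} → f-cong π ρ
  ; from-cong = λ {(π , _)} {(ρ , _)} → f-cong π ρ
  ; inverse   = (λ {(π , _)} {(ρ , _)} ρ≈fπ i → trans (f-cong ρ (f π) ρ≈fπ i) (f-involutive π i))
              , (λ {(π , _)} {(ρ , _)} ρ≈fπ i → trans (f-cong ρ (f π) ρ≈fπ i) (f-involutive π i))
  }

theorem4 : (m : ℕ) → 2 ≤ m → (n : ℕ) → 1 ≤ n → (k : ℕ)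
    → Inverse (PermSetoid n (λ π → a≡ m π k)) (PermSetoid n (λ π → b≡ m π k))
theorem4 1 (s≤s ()) n _ k
theorem4 (suc (suc d)) _ n _ k =
  involution⇒Inverse (Φ d) (Φ-cong d) (Φ-involutive d) (a≡⇒b≡Φ d) (b≡⇒a≡Φ d)
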